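{- Let $q>r\ge1$ and $g\ge3$ be integers. Let $G$ be an $r$-uniform hypergraph, $X\subseteq G$, and $A\subseteq G\setminus X$ a $K_q^r$-omni-absorber for $X$ with decomposition family $\mathcal{H}$ and decomposition function $\mathcal{Q}_A$. Let $B\subseteq G$ be a $K_q^r$-omni-booster for $A$ and $X$ with booster family $\mathcal{B}=(B_H:H\in\mathcal{H})$, and let $A\cup B$ be the canonical omni-absorber with decomposition function $\mathcal{Q}_{A\cup B}$. Then ${\rm Proj}_g(B,A,G,X)$ is a subtreasury of ${\rm Proj}_g(A\cup B,G,X)$.
   Context: $K_q^r$ is the complete $r$-graph on $q$ vertices; a $q$-clique is a copy of $K_q^r$, identified with its edge set. A $K_q^r$-packing/decomposition of an $r$-graph covers each edge at most/exactly once by $q$-cliques. $L$ is $K_q^r$-divisible if $\binom{q-i}{r-i}$ divides the number of edges of $L$ containing $S$ for every $i$-set $S$, $0\le i\le r-1$. A $K_q^r$-omni-absorber for $X$: $A$ with $V(A)=V(X)$, edge-disjoint from $X$, a family $\mathcal{H}$ of $q$-cliques of $X\cup A$ with $|H\cap X|\le1$, and a function $\mathcal{Q}_A$ assigning to each $K_q^r$-divisible $L\subseteq X$ a set $\mathcal{Q}_A(L)\subseteq\mathcal{H}$ of pairwise edge-disjoint cliques with union $L\cup A$. A rooted $K_q^r$-booster rooted at a $q$-clique $H$ is an $r$-graph $B_H$ edge-disjoint from $H$ with disjoint $K_q^r$-packings $(B_H)_{\rm off}$ (a decomposition of $B_H$) and $(B_H)_{\rm on}$ (a decomposition of $B_H\cup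 H$ not containing $H$). A $K_q^r$-omni-booster for $A$ and $X$ is an $r$-graph $B$ edge-disjoint from $A\cup X$ that is the edge-disjoint union of a family $\mathcal{B}=(B_H:H\in\mathcal{H})$ with each $B_H$ a rooted booster rooted at $H$. Its matching set $\mathcal{M}(\mathcal{B})$ is the set of all unions $\bigcup_{H\in\mathcal{H}}C_H$, with $C_H\in\{(B_H)_{\rm on},(B_H)_{\rm off}\}$, that consist of pairwise edge-disjoint $q$-cliques. The canonical omni-absorber is $A\cup B$ with $\mathcal{Q}_{A\cup B}(L)=\bigcup_{H\in\mathcal{Q}_A(L)}(B_H)_{\rm on}\cup\bigcup_{H\in\mathcal{H}\setminus\mathcal{Q}_A(L)}(B_H)_{\rm off}$. Hypergraphs: ${\rm Design}_{K_q^r}(G)$ (vertices $E(G)$, edges the $q$-cliques); ${\rm Reserve}_{K_q^r}(G,A',B')$ for disjoint $A',B'\subseteq E(G)$ (vertices $A'\cup B'$, edges the $q$-cliques $S\subseteq A'\cup B'$ with $|S\cap A'|=1$); ${\rm Girth}^g_{K_q^r}(G)$ (vertices the $q$-cliques of $G$, edges the sets of $i$ cliques, $3\le i\le g$, spanning at most $i(q-r)+r$ vertices and containing no $i'$ of them spanning at most $i'(q-r)+r$ vertices for $2\le i'<i$). ${\rm Treasury}^g_q(G,G',X)=({\rm Design}_{K_q^r}(G'\setminus X),{\rm Reserve}_{K_q^r}(G,G'\setminus X,X),{\rm Girth}^g_{K_q^r}(G))$. Common projection: for $T=(G_1,G_2,H)$ and $\mathcal{M}=\{M_1,\dots,M_k\}$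 with $M_i\subseteq V(H)$, $T\perp\mathcal{M}=(G_1',G_2',H')$ with $V(G_i')=V(G_i)$; $V(H')=V(H)$ minus all $v$ such that some $S\in E(H)$ and $i$ have $v\in S$, $v\notin M_i$, $S\setminus\{v\}\subseteq M_i$; $E(G_i')=E(G_i)\cap V(H')$; $E(H')=\{T'\subseteq V(H'):\exists S\in E(H),i\text{ with }T'\subseteq S,\ T'\cap M_i=\emptyset,\ S\setminus T'\subseteq M_i\}$. Define ${\rm Proj}_g(B,A,G,X)={\rm Treasury}^g_q(G,G\setminus(A\cup B),X)\perp\mathcal{M}(\mathcal{B})$ and ${\rm Proj}_g(A\cup B,G,X)={\rm Treasury}^g_q(G,G\setminus(A\cup B),X)\perp\{\mathcal{Q}_{A\cup B}(L):L\subseteq X\ K_q^r\text{ -divisible}\}$. A triple $(G_1',G_2',H')$ is a subtreasury of $(G_1,G_2,H)$ if each $G_i'$ is a spanning subhypergraph of $G_i$ and every edge of $H$ contained in $E(G_1')\cup E(G_2')$ is an edge of $H'$. -}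

module Defs where

open import Level using (0ℓ)
open import Data.Nat using (ℕ; _+_; _*_; _∸_; _≤_; _<_)
open import Data.Nat.Divisibility using (_∣_)
open import Data.Nat.Combinatorics using (_C_)
open import Data.Bool using (Bool; true; false; if_then_else_; T)
open import Data.Fin.Subset as FS using (Subset; ∣_∣; ⋃)
open import Data.List using (List; length)
open import Data.List.Membership.Propositional using (_∈_; _∉_)
open import Data.List.Relation.Unary.Unique.Propositional using (Unique)
open import Data.Product using (Σ; ∃; _×_; _,_)
open import Data.Sum using (_⊎_)
open import Data.Empty using (⊥)
open import Relation.Nullary using (¬_)
open import Relation.Unary using (Pred; _≐_; _⊆_)
open import Relation.Binary.PropositionalEquality using (_≡_; _≢_)
open import Function.Bundles using (_⇔_)

-- All hypergraphs live on the common vertex set Fin n.  An r-graph is given by its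
-- edge set, a predicate on 'Subset n' (together with r-uniformity where
-- needed).  A q-clique is represented by its q-element vertex set K; its
-- edge set (the identification used in the paper) is 'KEdge r K'.
-- A set of q-cliques is a predicate on 'Subset n'.

module _ {n : ℕ} where

  Graph : Set₁
  Graph = Pred (Subset n) 0ℓ

  Uniform : ℕ → Graph → Set
  Uniform r G = ∀ e → G e → ∣ e ∣ ≡ r

  _∖ᴳ_ : Graph → Graph → Graph
  (G ∖ᴳ X) e = G e × ¬ X e

  _∪ᴳ_ : Graph → Graph → Graph
  (G ∪ᴳ X) e = G e ⊎ X e

  EdgeDisjoint : Graph → Graph → Set
  EdgeDisjoint F F' = ∀ e → F e → F' e → ⊥

  KEdge : ℕ → Subset n → Subset n → Set
  KEdge r K e = (∣ e ∣ ≡ r) × (e FS.⊆ K)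

  IsClique : ℕ → ℕ → Graph → Subset n → Set
  IsClique r q F K = (∣ K ∣ ≡ q) × (∀ e → KEdge r K e → F e)

  PairwiseEdgeDisjoint : ℕ → Pred (Subset n) 0ℓ → Set
  PairwiseEdgeDisjoint r P =
    ∀ K K' → P K → P K' → K ≢ K' → ∀ e → KEdge r K e → KEdge r K' e → ⊥

  Covered : ℕ → Pred (Subset n) 0ℓ → Graph
  Covered r P e = ∃ λ K → P K × KEdge r K e

  IsDecomposition : ℕ → ℕ → Graph → Pred (Subset n) 0ℓ → Set
  IsDecomposition r q F P =
    (∀ K → P K → ∣ K ∣ ≡ q) × PairwiseEdgeDisjoint r P
    × (∀ e → F e → Covered r P e) × (∀ e → Covered r P e → F e)

  HasSize : Pred (Subset n) 0ℓ → ℕ → Set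
  HasSize P m = ∃ λ (ls : List (Subset n)) →
    Unique ls × (∀ x → P x ⇔ (x ∈ ls)) × (length ls ≡ m)

  Divisible : ℕ → ℕ → (Subset n → Bool) → Set
  Divisible r q L = ∀ i → i < r → ∀ (S : Subset n) → ∣ S ∣ ≡ i →
    ∃ λ m → HasSize (λ e → T (L e) × (S FS.⊆ e)) m × (((q ∸ i) C (r ∸ i)) ∣ m)

  -- K_q^r-omni-absorber A for X with decomposition family ℋ and
  -- decomposition function 𝒬 (sub-r-graphs L of X given as Bool-valued
  -- predicates; 𝒬 is required to depend only on the set L).
  record IsOmniAbsorber (r q : ℕ) (X A : Graph)
      (ℋ : Pred (Subset n) 0ℓ) (𝒬 : (Subset n → Bool) → Pred (Subset n) 0ℓ) : Set where
    field
      disjointAX : EdgeDisjoint A X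
      ℋ-clique   : ∀ H → ℋ H → IsClique r q (X ∪ᴳ A) H
      ℋ-X≤1      : ∀ H → ℋ H → ∀ e e' → KEdge r H e → X e → KEdge r H e' → X e' → e ≡ e'
      𝒬-ext      : ∀ L L' → (∀ e → L e ≡ L' e) → 𝒬 L ≐ 𝒬 L'
      𝒬-⊆ℋ      : ∀ L → (∀ e → T (L e) → X e) → Divisible r q L → ∀ K → 𝒬 L K → ℋ K
      𝒬-decomp   : ∀ L → (∀ e → T (L e) → X e) → Divisible r q L →
                   IsDecomposition r q ((λ e → T (L e)) ∪ᴳ A) (𝒬 L)

  -- data of a rooted booster: the r-graph B_H and the packings on / off
  record BoosterData : Set₁ where
    field
      graph : Graph
      on    : Pred (Subset n) 0ℓ
      off   : Pred (Subset n) 0ℓ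
  open BoosterData public

  IsRootedBooster : ℕ → ℕ → Subset n → BoosterData → Set
  IsRootedBooster r q H d =
    EdgeDisjoint (graph d) (KEdge r H)
    × IsDecomposition r q (graph d) (off d)
    × IsDecomposition r q (graph d ∪ᴳ KEdge r H) (on d)
    × ¬ on d H
    × (∀ K → on d K → off d K → ⊥)

  IsOmniBooster : ℕ → ℕ → Graph → Graph → Pred (Subset n) 0ℓ →
                  (Subset n → BoosterData) → Graph → Set
  IsOmniBooster r q A X ℋ 𝓑 B =
    EdgeDisjoint B (A ∪ᴳ X)
    × (∀ H → ℋ H → IsRootedBooster r q H (𝓑 H))
    × (B ≐ (λ e → ∃ λ H → ℋ H × graph (𝓑 H) e))
    × (∀ H H' → ℋ H → ℋ H' → H ≢ H' → EdgeDisjoint (graph (𝓑 H)) (graph (𝓑 H')))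

  ChoiceUnion : Pred (Subset n) 0ℓ → (Subset n → BoosterData) → (Subset n → Bool) →
                Pred (Subset n) 0ℓ
  ChoiceUnion ℋ 𝓑 c K = ∃ λ H → ℋ H × (if c H then on (𝓑 H) K else off (𝓑 H) K)

  -- index set of the matching set ℳ(𝓑): choices giving pairwise edge-disjoint cliques
  MatchIndex : ℕ → Pred (Subset n) 0ℓ → (Subset n → BoosterData) → Set
  MatchIndex r ℋ 𝓑 = Σ (Subset n → Bool) λ c → PairwiseEdgeDisjoint r (ChoiceUnion ℋ 𝓑 c)

  MatchMember : (r : ℕ) (ℋ : Pred (Subset n) 0ℓ) (𝓑 : Subset n → BoosterData) →
                MatchIndex r ℋ 𝓑 → Pred (Subset n) 0ℓ
  MatchMember r ℋ 𝓑 (c , _) = ChoiceUnion ℋ 𝓑 c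

  CanonicalQ : Pred (Subset n) 0ℓ → ((Subset n → Bool) → Pred (Subset n) 0ℓ) →
               (Subset n → BoosterData) → (Subset n → Bool) → Pred (Subset n) 0ℓ
  CanonicalQ ℋ 𝒬 𝓑 L K =
    ∃ λ H → ℋ H × ((𝒬 L H × on (𝓑 H) K) ⊎ (¬ 𝒬 L H × off (𝓑 H) K))

  DivIndex : ℕ → ℕ → Graph → Set
  DivIndex r q X = Σ (Subset n → Bool) λ L → (∀ e → T (L e) → X e) × Divisible r q L

  -- G₁, G₂: vertices are r-sets, edges are
  -- q-cliques (by vertex set).  H: vertices are q-cliques, an edge is a
  -- finite set of q-cliques, given by a list (only membership matters).
  record Treasury : Set₁ where
    field
      V₁ E₁ V₂ E₂ VH : Pred (Subset n) 0ℓ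
      EH : Pred (List (Subset n)) 0ℓ
  open Treasury public

  Design : ℕ → ℕ → Graph → Pred (Subset n) 0ℓ × Pred (Subset n) 0ℓ
  Design r q F = F , IsClique r q F

  Reserve : ℕ → ℕ → Graph → Graph → Graph → Pred (Subset n) 0ℓ × Pred (Subset n) 0ℓ
  Reserve r q G A' B' =
    (A' ∪ᴳ B') ,
    (λ K → IsClique r q (A' ∪ᴳ B') K
         × ∃ λ e → KEdge r K e × A' e × (∀ e' → KEdge r K e' → A' e' → e' ≡ e))

  span : List (Subset n) → ℕ
  span ls = ∣ ⋃ ls ∣

  GirthEdge : ℕ → ℕ → ℕ → Graph → Pred (List (Subset n)) 0ℓ
  GirthEdge r q g G ls =
    Unique ls × (∀ K → K ∈ ls → IsClique r q G K)
    × 3 ≤ length ls × length ls ≤ g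
    × span ls ≤ length ls * (q ∸ r) + r
    × (∀ (ls' : List (Subset n)) → Unique ls' → (∀ K → K ∈ ls' → K ∈ ls) →
         2 ≤ length ls' → length ls' < length ls →
         span ls' ≤ length ls' * (q ∸ r) + r → ⊥)

  TreasuryG : ℕ → ℕ → ℕ → Graph → Graph → Graph → Treasury
  TreasuryG r q g G G' X = record
    { V₁ = Data.Product.proj₁ (Design r q (G' ∖ᴳ X))
    ; E₁ = Data.Product.proj₂ (Design r q (G' ∖ᴳ X))
    ; V₂ = Data.Product.proj₁ (Reserve r q G (G' ∖ᴳ X) X)
    ; E₂ = Data.Product.proj₂ (Reserve r q G (G' ∖ᴳ X) X)
    ; VH = IsClique r q G
    ; EH = GirthEdge r q g G }

  Project : Treasury → (I : Set) → (I → Pred (Subset n) 0ℓ) → Treasury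
  Project T I M = record
    { V₁ = V₁ T ; V₂ = V₂ T
    ; E₁ = λ K → E₁ T K × VH' K
    ; E₂ = λ K → E₂ T K × VH' K
    ; VH = VH'
    ; EH = λ T' → (∀ v → v ∈ T' → VH' v) ×
        ∃ λ (S : List (Subset n)) → EH T S × ∃ λ (i : I) →
          (∀ v → v ∈ T' → v ∈ S) × (∀ v → v ∈ T' → ¬ M i v)
          × (∀ v → v ∈ S → v ∉ T' → M i v) }
    where
      VH' : Pred (Subset n) 0ℓ
      VH' v = VH T v × ¬ (∃ λ (S : List (Subset n)) → EH T S × ∃ λ (i : I) →
                v ∈ S × ¬ M i v × (∀ w → w ∈ S → w ≢ v → M i w))

  SubTreasury : Treasury → Treasury → Set
  SubTreasury T' T =
    (V₁ T' ≐ V₁ T) × (E₁ T' ⊆ E₁ T)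
    × (V₂ T' ≐ V₂ T) × (E₂ T' ⊆ E₂ T)
    × (∀ S → EH T S → (∀ K → K ∈ S → E₁ T' K ⊎ E₂ T' K) → EH T' S)

  ProjBooster : ℕ → ℕ → ℕ → Graph → Graph → Graph → Pred (Subset n) 0ℓ →
                (Subset n → BoosterData) → Graph → Treasury
  ProjBooster r q g G X A ℋ 𝓑 B =
    Project (TreasuryG r q g G (G ∖ᴳ (A ∪ᴳ B)) X) (MatchIndex r ℋ 𝓑) (MatchMember r ℋ 𝓑)

  ProjAbsorber : ℕ → ℕ → ℕ → Graph → Graph → Graph → Pred (Subset n) 0ℓ →
                 ((Subset n → Bool) → Pred (Subset n) 0ℓ) →
                 (Subset n → BoosterData) → Graph → Treasury
  ProjAbsorber r q g G X A ℋ 𝒬 𝓑 B =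
    Project (TreasuryG r q g G (G ∖ᴳ (A ∪ᴳ B)) X) (DivIndex r q X)
            (λ idx → CanonicalQ ℋ 𝒬 𝓑 (Data.Product.proj₁ idx))

{-# OPTIONS --safe #-}
module Submission where

-- Both projections remove cliques (and cut girth edges) according to a family of
-- clique sets: the canonical decompositions 𝒬_{A∪B}(L) on one side, the matchings
-- of ℳ(𝓑) on the other.  Every witness against the absorber family involves only
-- finitely many cliques of some 𝒬_{A∪B}(L); switching on the boosters rooted in
-- 𝒬_A(L) (and off all others) gives a matching containing those cliques, and a
-- clique of the matching that has no edge in B is itself in 𝒬_{A∪B}(L), because
-- every clique of an off-packing has an edge in B.  Treasury cliques avoid B, so
-- each witness transfers, and the booster projection keeps no more than the
-- absorber projection.

open import Defs
open import Level using (0ℓ)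
open import Data.Nat using (ℕ; zero; suc; _≤_; _<_; z≤n; s≤s)
open import Data.Nat.Properties using (<⇒≤)
open import Data.Bool using (Bool; true; false; if_then_else_; T)
import Data.Bool.Properties as Bool
open import Data.Unit using (tt)
open import Data.Fin.Subset as FS using (Subset; inside; outside; ∣_∣)
open import Data.Fin.Subset.Properties using (∉⊥; ∣⊥∣≡0)
open import Data.Vec using (_∷_; []; here; there)
open import Data.Vec.Properties using (≡-dec)
open import Data.List using (List; []; _∷_; filter)
open import Data.List.Relation.Unary.Any using (here; there)
open import Data.List.Relation.Unary.All as All using (All; []; _∷_)
open import Data.List.Membership.Propositional using (_∈_)
open import Data.List.Membership.Propositional.Properties using (∈-filter⁺; ∈-filter⁻)
open import Data.Product using (∃; _×_; _,_; proj₁; proj₂)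
open import Data.Sum using (_⊎_; inj₁; inj₂; [_,_])
import Data.Sum as Sum
open import Data.Empty using (⊥; ⊥-elim)
open import Relation.Nullary using (¬_; yes; no; ¬?)
open import Relation.Nullary.Decidable using (isYes; fromWitness; toWitness)
open import Relation.Unary using (Pred; _⊆_; ∁)
open import Relation.Binary.Definitions using (DecidableEquality)
open import Relation.Binary.PropositionalEquality using (_≡_; refl; cong)
open import Function using (id)

subset-of-size : ∀ {m} (p : Subset m) k → k ≤ ∣ p ∣ → ∃ λ e → ∣ e ∣ ≡ k × e FS.⊆ p
subset-of-size [] zero z≤n = [] , refl , λ ()
subset-of-size {suc m} (inside ∷ p) zero _ = FS.⊥ , ∣⊥∣≡0 (suc m) , λ x∈⊥ → ⊥-elim (∉⊥ x∈⊥)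
subset-of-size (inside ∷ p) (suc k) (s≤s k≤∣p∣) with subset-of-size p k k≤∣p∣
... | e , ∣e∣≡k , e⊆p = inside ∷ e , cong suc ∣e∣≡k , λ { here → here ; (there x∈e) → there (e⊆p x∈e) }
subset-of-size (outside ∷ p) k k≤∣p∣ with subset-of-size p k k≤∣p∣
... | e , ∣e∣≡k , e⊆p = outside ∷ e , ∣e∣≡k , λ { (there x∈e) → there (e⊆p x∈e) }

module _ {n : ℕ} where

  _≟ˢ_ : DecidableEquality (Subset n)
  _≟ˢ_ = ≡-dec Bool._≟_

  open import Data.List.Membership.DecPropositional _≟ˢ_ using (_∈?_; _∉?_)

  isClique-mono : ∀ {r q} {F F' : Graph {n}} → F ⊆ F' → IsClique r q F ⊆ IsClique r q F'
  isClique-mono F⊆F' (∣K∣≡q , edges) = ∣K∣≡q , λ e e∈K → F⊆F' (edges e e∈K)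

  isClique-edge : ∀ {r q} {F : Graph {n}} {K} → r ≤ q → IsClique r q F K → ∃ λ e → KEdge r K e
  isClique-edge {r} {K = K} r≤q (refl , _) = subset-of-size K r r≤q

  Refines : {I J : Set} → Pred (Subset n) 0ℓ →
            (I → Pred (Subset n) 0ℓ) → (J → Pred (Subset n) 0ℓ) → Set
  Refines {I} Good M M' = ∀ j (W : List (Subset n)) → (∀ w → w ∈ W → M' j w) →
    ∃ λ (i : I) → (∀ w → w ∈ W → M i w) × (∀ K → Good K → M i K → M' j K)

  module _ (𝒯 : Treasury {n}) {I J : Set} {Good : Pred (Subset n) 0ℓ}
           {M : I → Pred (Subset n) 0ℓ} {M' : J → Pred (Subset n) 0ℓ}
           (refines : Refines Good M M') where

    project-VH-mono : ∀ K → Good K → VH (Project 𝒯 I M) K → VH (Project 𝒯 J M') K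
    project-VH-mono K good (K∈VH , unremoved) =
      K∈VH , λ (S , S∈EH , j , K∈S , K∉M'j , others) →
        let W = filter (λ w → ¬? (w ≟ˢ K)) S
            i , W⊆Mi , Mi⊆M'j = refines j W λ w w∈W →
              let w∈S , w≢K = ∈-filter⁻ (λ w → ¬? (w ≟ˢ K)) w∈W in others w w∈S w≢K
        in unremoved (S , S∈EH , i , K∈S , (λ K∈Mi → K∉M'j (Mi⊆M'j K good K∈Mi)) ,
                      λ w w∈S w≢K → W⊆Mi w (∈-filter⁺ (λ w → ¬? (w ≟ˢ K)) w∈S w≢K))

    project-EH-mono : ∀ S → EH (Project 𝒯 J M') S →
                      (∀ K → K ∈ S → Good K × VH (Project 𝒯 I M) K) → EH (Project 𝒯 I M) S
    project-EH-mono S (_ , S₀ , S₀∈EH , j , S⊆S₀ , S∩M'j≡∅ , S₀∖S⊆M'j) good-unremoved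
      with i , W⊆Mi , Mi⊆M'j ← refines j (filter (_∉? S) S₀) (λ w w∈W →
             let w∈S₀ , w∉S = ∈-filter⁻ (_∉? S) w∈W in S₀∖S⊆M'j w w∈S₀ w∉S) =
      (λ K K∈S → proj₂ (good-unremoved K K∈S)) , S₀ , S₀∈EH , i , S⊆S₀ ,
      (λ K K∈S K∈Mi → S∩M'j≡∅ K K∈S (Mi⊆M'j K (proj₁ (good-unremoved K K∈S)) K∈Mi)) ,
      λ w w∈S₀ w∉S → W⊆Mi w (∈-filter⁺ (_∉? S) w∈S₀ w∉S)

    project-subTreasury : E₁ 𝒯 ⊆ Good → E₂ 𝒯 ⊆ Good →
                          SubTreasury (Project 𝒯 I M) (Project 𝒯 J M')
    project-subTreasury E₁⊆Good E₂⊆Good =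
      (id , id) ,
      (λ { {K} (K∈E₁ , K∈VH) → K∈E₁ , project-VH-mono K (E₁⊆Good K∈E₁) K∈VH }) ,
      (id , id) ,
      (λ { {K} (K∈E₂ , K∈VH) → K∈E₂ , project-VH-mono K (E₂⊆Good K∈E₂) K∈VH }) ,
      λ S S∈EH S⊆E → project-EH-mono S S∈EH λ K K∈S →
        [ (λ (K∈E₁ , K∈VH) → E₁⊆Good K∈E₁ , K∈VH) , (λ (K∈E₂ , K∈VH) → E₂⊆Good K∈E₂ , K∈VH) ]
          (S⊆E K K∈S)

  Chosen : Bool → BoosterData {n} → Pred (Subset n) 0ℓ
  Chosen b d K = if b then on d K else off d K

  chosen-on : ∀ {b d K} → T b → on d K → Chosen b d K
  chosen-on {true} _ K∈on = K∈on

  chosen-off : ∀ {b d K} → ¬ T b → off d K → Chosen b d K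
  chosen-off {true} ¬Tb _ = ⊥-elim (¬Tb tt)
  chosen-off {false} _ K∈off = K∈off

  chosen-pairwise : ∀ {r q H d} → IsRootedBooster r q H d →
                    ∀ b → PairwiseEdgeDisjoint r (Chosen b d)
  chosen-pairwise (_ , _ , (_ , on-pairwise , _) , _) true = on-pairwise
  chosen-pairwise (_ , (_ , off-pairwise , _) , _) false = off-pairwise

  chosen-edge : ∀ {r q H d} → IsRootedBooster r q H d →
                ∀ b {K e} → Chosen b d K → KEdge r K e → graph d e ⊎ (T b × KEdge r H e)
  chosen-edge (_ , _ , (_ , _ , _ , on-covered) , _) true {K} {e} K∈on e∈K =
    Sum.map₂ (tt ,_) (on-covered e (K , K∈on , e∈K))
  chosen-edge (_ , (_ , _ , _ , off-covered) , _) false {K} {e} K∈off e∈K =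
    inj₁ (off-covered e (K , K∈off , e∈K))

  treasury-cliques : ∀ {r q g} {G G' X F : Graph {n}} → G' ⊆ F → X ⊆ F →
    (E₁ (TreasuryG r q g G G' X) ⊆ IsClique r q F) × (E₂ (TreasuryG r q g G G' X) ⊆ IsClique r q F)
  treasury-cliques G'⊆F X⊆F =
    isClique-mono (λ (e∈G' , _) → G'⊆F e∈G') ,
    λ (K-clique , _) → isClique-mono [ (λ (e∈G' , _) → G'⊆F e∈G') , X⊆F ] K-clique

  module OmniBooster {r q : ℕ} {X A B : Graph {n}} {ℋ : Pred (Subset n) 0ℓ}
      {𝒬 : (Subset n → Bool) → Pred (Subset n) 0ℓ} (absorber : IsOmniAbsorber r q X A ℋ 𝒬)
      {𝓑 : Subset n → BoosterData} (booster : IsOmniBooster r q A X ℋ 𝓑 B) where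

    open IsOmniAbsorber absorber

    rooted-booster : ∀ {H} → ℋ H → IsRootedBooster r q H (𝓑 H)
    rooted-booster {H} H∈ℋ = proj₁ (proj₂ booster) H H∈ℋ

    booster⊆B : ∀ {H} → ℋ H → graph (𝓑 H) ⊆ B
    booster⊆B {H} H∈ℋ e∈BH = proj₂ (proj₁ (proj₂ (proj₂ booster))) (H , H∈ℋ , e∈BH)

    booster-avoids-roots : ∀ {H H' e} → ℋ H → ℋ H' → graph (𝓑 H) e → KEdge r H' e → ⊥
    booster-avoids-roots {H' = H'} {e} H∈ℋ H'∈ℋ e∈BH e∈H' =
      proj₁ booster e (booster⊆B H∈ℋ e∈BH) (Sum.swap (proj₂ (ℋ-clique H' H'∈ℋ) e e∈H'))

    choiceUnion-pairwise : ∀ {Q} → PairwiseEdgeDisjoint r Q →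
      ∀ c → (∀ H → T (c H) → Q H) → PairwiseEdgeDisjoint r (ChoiceUnion ℋ 𝓑 c)
    choiceUnion-pairwise Q-pairwise c c⊆Q K K' (H , H∈ℋ , K∈C) (H' , H'∈ℋ , K'∈C) K≢K' e e∈K e∈K'
      with H ≟ˢ H'
    ... | yes refl = chosen-pairwise (rooted-booster H∈ℋ) (c H) K K' K∈C K'∈C K≢K' e e∈K e∈K'
    ... | no H≢H'
      with chosen-edge (rooted-booster H∈ℋ) (c H) K∈C e∈K
         | chosen-edge (rooted-booster H'∈ℋ) (c H') K'∈C e∈K'
    ... | inj₁ e∈BH | inj₁ e∈BH' = proj₂ (proj₂ (proj₂ booster)) H H' H∈ℋ H'∈ℋ H≢H' e e∈BH e∈BH'
    ... | inj₁ e∈BH | inj₂ (_ , e∈H') = booster-avoids-roots H∈ℋ H'∈ℋ e∈BH e∈H'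
    ... | inj₂ (_ , e∈H) | inj₁ e∈BH' = booster-avoids-roots H'∈ℋ H∈ℋ e∈BH' e∈H
    ... | inj₂ (cH , e∈H) | inj₂ (cH' , e∈H') =
      Q-pairwise H H' (c⊆Q H cH) (c⊆Q H' cH') H≢H' e e∈H e∈H'

    module _ (L : Subset n → Bool) where

      choiceUnion⊆canonical : r ≤ q → ∀ c → (∀ H → T (c H) → 𝒬 L H) →
        ∀ {K} → IsClique r q (∁ B) K → ChoiceUnion ℋ 𝓑 c K → CanonicalQ ℋ 𝒬 𝓑 L K
      choiceUnion⊆canonical r≤q c c⊆𝒬L {K} K-avoids-B (H , H∈ℋ , K∈C) =
        H , H∈ℋ , chosen⊆canonical (c H) (c⊆𝒬L H) K∈C
        where
          chosen⊆canonical : ∀ b → (T b → 𝒬 L H) → Chosen b (𝓑 H) K →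
                             (𝒬 L H × on (𝓑 H) K) ⊎ (¬ 𝒬 L H × off (𝓑 H) K)
          chosen⊆canonical true b⊆𝒬L K∈on = inj₁ (b⊆𝒬L tt , K∈on)
          chosen⊆canonical false _ K∈off
            with e , e∈K ← isClique-edge r≤q K-avoids-B
            with chosen-edge (rooted-booster H∈ℋ) false K∈off e∈K
          ... | inj₁ e∈BH = ⊥-elim (proj₂ K-avoids-B e e∈K (booster⊆B H∈ℋ e∈BH))

      -- 𝒬 L is not decidable, so the choice of on-packings is read off from a finite
      -- list of roots in 𝒬 L, collected from the witnesses of the cliques at hand.
      RootedIn : List (Subset n) → Subset n → Set
      RootedIn Hs w = ∃ λ H → ℋ H × ((H ∈ Hs × on (𝓑 H) w) ⊎ (¬ 𝒬 L H × off (𝓑 H) w))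

      rootedIn-there : ∀ {H Hs w} → RootedIn Hs w → RootedIn (H ∷ Hs) w
      rootedIn-there (H , H∈ℋ , inj₁ (H∈Hs , w∈on)) = H , H∈ℋ , inj₁ (there H∈Hs , w∈on)
      rootedIn-there (H , H∈ℋ , inj₂ w-off) = H , H∈ℋ , inj₂ w-off

      collect-on-roots : ∀ W → (∀ w → w ∈ W → CanonicalQ ℋ 𝒬 𝓑 L w) →
        ∃ λ Hs → All (𝒬 L) Hs × (∀ w → w ∈ W → RootedIn Hs w)
      collect-on-roots [] _ = [] , [] , λ _ ()
      collect-on-roots (w ∷ W) W⊆CQ
        with Hs , Hs⊆𝒬L , W-rooted ← collect-on-roots W (λ v v∈W → W⊆CQ v (there v∈W))
        with W⊆CQ w (here refl)
      ... | H , H∈ℋ , inj₁ (H∈𝒬L , w∈on) =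
        H ∷ Hs , H∈𝒬L ∷ Hs⊆𝒬L ,
        λ { _ (here refl) → H , H∈ℋ , inj₁ (here refl , w∈on)
          ; v (there v∈W) → rootedIn-there (W-rooted v v∈W) }
      ... | H , H∈ℋ , inj₂ w-off =
        Hs , Hs⊆𝒬L ,
        λ { _ (here refl) → H , H∈ℋ , inj₂ w-off
          ; v (there v∈W) → W-rooted v v∈W }

      canonical-matching : PairwiseEdgeDisjoint r (𝒬 L) → r ≤ q →
        ∀ W → (∀ w → w ∈ W → CanonicalQ ℋ 𝒬 𝓑 L w) →
        ∃ λ (i : MatchIndex r ℋ 𝓑) → (∀ w → w ∈ W → MatchMember r ℋ 𝓑 i w) ×
          (∀ K → IsClique r q (∁ B) K → MatchMember r ℋ 𝓑 i K → CanonicalQ ℋ 𝒬 𝓑 L K)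
      canonical-matching 𝒬L-pairwise r≤q W W⊆CQ
        with Hs , Hs⊆𝒬L , W-rooted ← collect-on-roots W W⊆CQ =
        (c , choiceUnion-pairwise 𝒬L-pairwise c c⊆𝒬L) ,
        (λ w w∈W → chosen (W-rooted w w∈W)) ,
        λ K K-avoids-B → choiceUnion⊆canonical r≤q c c⊆𝒬L K-avoids-B
        where
          c : Subset n → Bool
          c H = isYes (H ∈? Hs)

          c⊆𝒬L : ∀ H → T (c H) → 𝒬 L H
          c⊆𝒬L H cH = All.lookup Hs⊆𝒬L (toWitness cH)

          chosen : ∀ {w} → RootedIn Hs w → ChoiceUnion ℋ 𝓑 c w
          chosen (H , H∈ℋ , inj₁ (H∈Hs , w∈on)) =
            H , H∈ℋ , chosen-on {c H} {𝓑 H} (fromWitness H∈Hs) w∈on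
          chosen (H , H∈ℋ , inj₂ (H∉𝒬L , w∈off)) =
            H , H∈ℋ , chosen-off {c H} {𝓑 H} (λ cH → H∉𝒬L (c⊆𝒬L H cH)) w∈off

    matchings-refine-canonical : r ≤ q →
      Refines (IsClique r q (∁ B)) (MatchMember r ℋ 𝓑)
              (λ (L : DivIndex r q X) → CanonicalQ ℋ 𝒬 𝓑 (proj₁ L))
    matchings-refine-canonical r≤q (L , L⊆X , L-divisible) =
      canonical-matching L (proj₁ (proj₂ (𝒬-decomp L L⊆X L-divisible))) r≤q

mainTheorem9 : {n : ℕ} (q r g : ℕ) → 1 ≤ r → r < q → 3 ≤ g →
    (G X A B : Graph {n}) → Uniform r G → X ⊆ G → A ⊆ (G ∖ᴳ X) → B ⊆ G →
    (ℋ : Pred (Subset n) 0ℓ) (𝒬 : (Subset n → Bool) → Pred (Subset n) 0ℓ) →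
    IsOmniAbsorber r q X A ℋ 𝒬 →
    (𝓑 : Subset n → BoosterData {n}) → IsOmniBooster r q A X ℋ 𝓑 B →
    SubTreasury (ProjBooster r q g G X A ℋ 𝓑 B) (ProjAbsorber r q g G X A ℋ 𝒬 𝓑 B)
mainTheorem9 q r g _ r<q _ G X A B _ _ _ _ ℋ 𝒬 absorber 𝓑 booster =
  let E₁-avoids-B , E₂-avoids-B = treasury-cliques {r = r} {q} {g} {G} rest-avoids-B X-avoids-B
  in project-subTreasury (TreasuryG r q g G (G ∖ᴳ (A ∪ᴳ B)) X)
       (OmniBooster.matchings-refine-canonical absorber booster (<⇒≤ r<q)) E₁-avoids-B E₂-avoids-B
  where
    rest-avoids-B : G ∖ᴳ (A ∪ᴳ B) ⊆ ∁ B
    rest-avoids-B (_ , e∉A∪B) e∈B = e∉A∪B (inj₂ e∈B)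

    X-avoids-B : X ⊆ ∁ B
    X-avoids-B e∈X e∈B = proj₁ booster _ e∈B (inj₂ e∈X)
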